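{- Let $F$ be a clause-set and $v\in\mathrm{var}(F)$. Then either (1) there is $\varepsilon\in\{0,1\}$ with $\mathrm{hd}(\langle v\to\varepsilon\rangle*F)=\mathrm{hd}(F)$ and $\mathrm{hd}(\langle v\to 1-\varepsilon\rangle*F)\le\mathrm{hd}(F)$, or (2) $\mathrm{hd}(\langle v\to0\rangle*F)=\mathrm{hd}(\langle v\to1\rangle*F)=\mathrm{hd}(F)-1$. Moreover, if $F$ is unsatisfiable and $\mathrm{hd}(F)>0$, then there are $v\in\mathrm{var}(F)$ and $\varepsilon\in\{0,1\}$ with $\mathrm{hd}(\langle v\to\varepsilon\rangle*F)<\mathrm{hd}(F)$.
   Context: Literals are variables $v$ or negations $\overline{v}$; clauses finite sets of literals without complementary pair; clause-sets finite sets of clauses; $\bot$ empty clause, $\top$ empty clause-set; $\mathrm{var}(F)$ set of variables of $F$. A partial assignment maps finitely many variables to $\{0,1\}$; $\langle v\to\varepsilon\rangle$ sets only $v$ to $\varepsilon$; $\varphi*F$ removes satisfied clauses and false literals; $F$ unsatisfiable if no $\varphi$ gives $\varphi*F=\top$. Resolution: $C,D$ with exactly one clash $x\in C,\overline{x}\in D$ have resolvent $(C\cup D)\setminus\{x,\overline{x}\}$. Resolution tree: finite rooted tree, inner nodes with two children, labelled by clauses, inner labels resolvents of children's labels; refutation of $F$: leaf labels in $F$, root label $\bot$. Horton–Strahler number: $0$ for one node; for root subtrees $T_1,T_2$: $\mathrm{hts}(T_1)+1$ if $\mathrm{hts}(T_1)=\mathrm{hts}(T_2)$, otherwise the maximum.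 For unsatisfiable $F$, $\mathrm{hd}(F)$ is the minimum Horton–Strahler number of a refutation of $F$. Extension: $\mathrm{hd}(\top)=0$, and for $F\ne\top$, $\mathrm{hd}(F)=\max\{\mathrm{hd}(\varphi*F):\varphi*F\text{ unsatisfiable}\}$. -}

module Defs where

open import Data.Nat using (ℕ; zero; suc; _≤_; _⊔_; _≡ᵇ_)
open import Data.Bool using (Bool; true; false; not; if_then_else_; _∧_; _∨_)
open import Data.Product using (Σ; ∃; _×_; _,_)
open import Data.Sum using (_⊎_)
open import Data.List using (List; []; _∷_)
open import Data.List.Relation.Unary.All using (All)
open import Data.List.Relation.Unary.Any using (Any)
open import Data.List.Membership.Propositional using (_∈_)
open import Data.Maybe using (Maybe; just; nothing)
open import Relation.Binary.PropositionalEquality using (_≡_; _≢_)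
open import Relation.Nullary using (¬_)
open import Data.Unit using () renaming (⊤ to ⊤')
open import Function.Bundles using (_⇔_)

Var : Set
Var = ℕ

-- A literal: a variable together with a sign
-- (sign true = positive literal v, sign false = negative literal v̄).
record Lit : Set where
  constructor lit
  field
    var  : Var
    sign : Bool
open Lit public

compl : Lit → Lit
compl (lit v s) = lit v (not s)

-- Clauses are finite sets of literals, represented by lists read as sets
-- (only membership matters).
Cl : Set
Cl = List Lit

IsClause : Cl → Set
IsClause C = ∀ v → ¬ (lit v true ∈ C × lit v false ∈ C)

_≈C_ : Cl → Cl → Set
C ≈C D = ∀ l → (l ∈ C) ⇔ (l ∈ D)

-- Clause-sets: finite sets of clauses, represented by lists read as sets.
CS : Set
CS = List Cl

IsClauseSet : CS → Set
IsClauseSet F = All IsClause F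

_∈CS_ : Cl → CS → Set
C ∈CS F = Any (λ D → C ≈C D) F

_∈var_ : Var → CS → Set
v ∈var F = Any (λ C → Σ Bool λ s → lit v s ∈ C) F

-- A partial assignment is a finite list of bindings; the value of a
-- variable is given by its first binding (so it maps finitely many
-- variables to {0,1}; false = 0, true = 1).
PA : Set
PA = List (Var × Bool)

lookupPA : PA → Var → Maybe Bool
lookupPA [] v = nothing
lookupPA ((w , b) ∷ φ) v = if v ≡ᵇ w then just b else lookupPA φ v

⟨_↦_⟩ : Var → Bool → PA
⟨ v ↦ ε ⟩ = (v , ε) ∷ []

eqB : Bool → Bool → Bool
eqB true true = true
eqB false false = true
eqB _ _ = false

litTrue : PA → Lit → Bool
litTrue φ (lit v s) with lookupPA φ v
... | just b  = eqB b s
... | nothing = false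

litFalse : PA → Lit → Bool
litFalse φ (lit v s) with lookupPA φ v
... | just b  = not (eqB b s)
... | nothing = false

clauseSat : PA → Cl → Bool
clauseSat φ [] = false
clauseSat φ (l ∷ C) = litTrue φ l ∨ clauseSat φ C

shorten : PA → Cl → Cl
shorten φ [] = []
shorten φ (l ∷ C) = if litFalse φ l then shorten φ C else l ∷ shorten φ C

_*_ : PA → CS → CS
φ * [] = []
φ * (C ∷ F) = if clauseSat φ C then φ * F else shorten φ C ∷ (φ * F)

Satisfiable : CS → Set
Satisfiable F = Σ PA λ φ → φ * F ≡ []

Unsat : CS → Set
Unsat F = ¬ Satisfiable F

Resolvent : Cl → Cl → Cl → Set
Resolvent C D R =
  Σ Lit λ x → (x ∈ C) × (compl x ∈ D)
    × (∀ l → l ∈ C → compl l ∈ D → l ≡ x)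
    × (∀ l → (l ∈ R) ⇔ (((l ∈ C) ⊎ (l ∈ D)) × (var l ≢ var x)))

data RTree : Set where
  leaf : Cl → RTree
  node : Cl → RTree → RTree → RTree

label : RTree → Cl
label (leaf C) = C
label (node C _ _) = C

ValidTree : RTree → Set
ValidTree (leaf C) = ⊤'
ValidTree (node R T₁ T₂) = ValidTree T₁ × ValidTree T₂ × Resolvent (label T₁) (label T₂) R

LeavesIn : CS → RTree → Set
LeavesIn F (leaf C) = C ∈CS F
LeavesIn F (node _ T₁ T₂) = LeavesIn F T₁ × LeavesIn F T₂

Refutation : CS → RTree → Set
Refutation F T = ValidTree T × LeavesIn F T × label T ≡ []

hts : RTree → ℕ
hts (leaf _) = 0
hts (node _ T₁ T₂) =
  if hts T₁ ≡ᵇ hts T₂ then suc (hts T₁) else hts T₁ ⊔ hts T₂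

-- Hardness hd, as a relation  HD F k  meaning  hd(F) = k.

HDunsat : CS → ℕ → Set
HDunsat F k =
  (Σ RTree λ T → Refutation F T × hts T ≡ k)
  × (∀ T → Refutation F T → k ≤ hts T)

data HD : CS → ℕ → Set where
  hd-unsat : ∀ {F k} → Unsat F → HDunsat F k → HD F k
  hd-top   : HD [] 0
  hd-sat   : ∀ {F k} → Satisfiable F → F ≢ [] →
             (Σ PA λ φ → Unsat (φ * F) × HDunsat (φ * F) k) →
             (∀ φ j → Unsat (φ * F) → HDunsat (φ * F) j → j ≤ k) →
             HD F k

-- hd(F) ≤ k iff ⊥ ∈ F, or hd(⟨v→ε⟩*F) < k and hd(⟨v→¬ε⟩*F) ≤ k for some variable v
-- and value ε. A refutation splits along the variable resolved at its root; conversely a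
-- refutation of ⟨v→ε⟩*F lifts to a derivation from F of ⊥ or of the unit clause {v→¬ε},
-- and the two lifted derivations resolve on v, the Horton–Strahler numbers combining as
-- at a tree node. This splitting relation is decidable by recursion on the size of F, so
-- minima exist, and hd(F) is the maximal hardness of an unsatisfiable instance φ*F, where
-- φ may be restricted to var(F).
-- (1) Take an instance φ*F of hardness a = hd(F). If φ assigns v, it is an instance of
-- ⟨v→φ(v)⟩*F, which therefore has hardness a. Otherwise φ*F splits on v into instances
-- of ⟨v→0⟩*F and ⟨v→1⟩*F of hardness c₀ ≤ b₀ ≤ a and c₁ ≤ b₁ ≤ a, and a being at most the
-- Horton–Strahler combination of c₀ and c₁ forces b₀ = a, b₁ = a or b₀ = b₁ = a − 1.
-- (2) A minimal splitting of F splits on a variable of F, and its first branch has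
-- hardness hd(F) − 1.
module Submission where

open import Defs
open import Data.Nat using (ℕ; zero; suc; _≤_; _<_; _+_; _⊔_; _≡ᵇ_; z≤n; s≤s)
open import Data.Nat.Properties
open import Data.Bool using (Bool; true; false; not; if_then_else_; _∨_; T)
open import Data.Bool.Properties using (not-involutive; ∨-zeroʳ; ¬-not; not-¬)
open import Data.Product using (Σ; ∃; ∃₂; _×_; _,_; proj₁; proj₂)
open import Data.Sum using (_⊎_; inj₁; inj₂; [_,_]′)
open import Data.List using (List; []; _∷_; _++_; length; map)
open import Data.List.Properties using (≡-dec)
open import Data.List.Relation.Unary.Any using (Any; here; there; any?; satisfied; tail)
open import Data.List.Relation.Unary.All using ([]; _∷_; lookupAny)
open import Data.List.Membership.Propositional using (_∈_; _∉_; find; lose)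
open import Data.List.Membership.Propositional.Properties using (∈-++⁺ˡ; ∈-++⁺ʳ; ∈-++⁻; ∈-map⁺; ∈-map⁻; ∈-length)
open import Data.Maybe using (Maybe; just; nothing; _<∣>_)
open import Data.Empty using (⊥-elim)
open import Data.Unit using (tt)
open import Function using (_∘_; flip; id; case_of_)
open import Function.Bundles using (Equivalence; mk⇔; _⇔_)
open import Relation.Binary.PropositionalEquality
open import Relation.Nullary using (¬_; Dec; yes; no; map′; _×-dec_; _⊎-dec_)
open import Relation.Binary.Definitions using (DecidableEquality; tri<; tri≈; tri>)

≡ᵇ-refl : ∀ m → (m ≡ᵇ m) ≡ true
≡ᵇ-refl zero = refl
≡ᵇ-refl (suc m) = ≡ᵇ-refl m

≢⇒≡ᵇ-false : ∀ m n → m ≢ n → (m ≡ᵇ n) ≡ false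
≢⇒≡ᵇ-false zero zero m≢n = ⊥-elim (m≢n refl)
≢⇒≡ᵇ-false zero (suc n) _ = refl
≢⇒≡ᵇ-false (suc m) zero _ = refl
≢⇒≡ᵇ-false (suc m) (suc n) m≢n = ≢⇒≡ᵇ-false m n (m≢n ∘ cong suc)

≡ᵇ-true⇒≡ : ∀ m n → (m ≡ᵇ n) ≡ true → m ≡ n
≡ᵇ-true⇒≡ m n e = ≡ᵇ⇒≡ m n (subst T (sym e) tt)

∨-false⁻ : ∀ a b → a ∨ b ≡ false → a ≡ false × b ≡ false
∨-false⁻ false b e = refl , e

∨-true⁻ : ∀ a b → a ∨ b ≡ true → a ≡ true ⊎ b ≡ true
∨-true⁻ true  b _ = inj₁ refl
∨-true⁻ false b e = inj₂ e

any?-∈ : ∀ {A : Set} {Q : A → Set} xs → (∀ {x} → x ∈ xs → Dec (Q x)) → Dec (Any Q xs)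
any?-∈ [] _ = no λ ()
any?-∈ (x ∷ xs) Q? = map′ [ here , there ]′ (λ { (here q) → inj₁ q ; (there q) → inj₂ q })
                           (Q? (here refl) ⊎-dec any?-∈ xs (Q? ∘ there))

Σ-Bool? : ∀ {Q : Bool → Set} → Dec (Q false) → Dec (Q true) → Dec (Σ Bool Q)
Σ-Bool? Q₀? Q₁? = map′ [ (false ,_) , (true ,_) ]′ (λ { (false , q) → inj₁ q ; (true , q) → inj₂ q })
                       (Q₀? ⊎-dec Q₁?)

least : ∀ {Q : ℕ → Set} → (∀ k → Dec (Q k)) → ∀ {n} → Q n → Σ ℕ λ k → Q k × (∀ j → Q j → k ≤ j)
least {Q} Q? {n} qn = least-upTo n (n , ≤-refl , qn)
  where
  least-upTo : ∀ m → (∃ λ j → j ≤ m × Q j) → Σ ℕ λ k → Q k × (∀ j → Q j → k ≤ j)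
  least-upTo m (j , j≤m , qj) with anyUpTo? Q? m
  least-upTo zero    _ | yes (_ , () , _)
  least-upTo (suc m) _ | yes (i , s≤s i≤m , qi) = least-upTo m (i , i≤m , qi)
  least-upTo m (j , j≤m , qj) | no none-below =
    j , qj , λ i qi → ≮⇒≥ λ i<j → none-below (i , <-≤-trans i<j j≤m , qi)

maximum : ∀ {A : Set} (V : A → ℕ → Set) → (∀ x → Dec (∃ (V x))) →
          (∀ {x j k} → V x j → V x k → j ≡ k) → ∀ xs →
          (∃₂ λ x k → x ∈ xs × V x k × ∀ y j → y ∈ xs → V y j → j ≤ k) ⊎ (∀ y j → y ∈ xs → ¬ V y j)
maximum V V? functional [] = inj₂ λ _ _ ()
maximum V V? functional (x ∷ xs) with V? x | maximum V V? functional xs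
... | no ¬Vx | inj₂ none = inj₂ λ where
  y j (here refl) → ¬Vx ∘ (j ,_)
  y j (there y∈)  → none y j y∈
... | no ¬Vx | inj₁ (m , k , m∈ , Vmk , k-max) = inj₁ (m , k , there m∈ , Vmk , λ where
  y j (here refl) Vyj → ⊥-elim (¬Vx (j , Vyj))
  y j (there y∈)      → k-max y j y∈)
... | yes (i , Vxi) | inj₂ none = inj₁ (x , i , here refl , Vxi , λ where
  y j (here refl) Vyj → ≤-reflexive (functional Vyj Vxi)
  y j (there y∈)  Vyj → ⊥-elim (none y j y∈ Vyj))
... | yes (i , Vxi) | inj₁ (m , k , m∈ , Vmk , k-max) with i ≤? k
...   | yes i≤k = inj₁ (m , k , there m∈ , Vmk , λ where
  y j (here refl) Vyj → ≤-trans (≤-reflexive (functional Vyj Vxi)) i≤k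
  y j (there y∈)      → k-max y j y∈)
...   | no i≰k = inj₁ (x , i , here refl , Vxi , λ where
  y j (here refl) Vyj → ≤-reflexive (functional Vyj Vxi)
  y j (there y∈)  Vyj → ≤-trans (k-max y j y∈ Vyj) (<⇒≤ (≰⇒> i≰k)))

_≟L_ : DecidableEquality Lit
lit v s ≟L lit w t =
  map′ (λ { (refl , refl) → refl }) (λ { refl → refl , refl }) ((v Data.Nat.≟ w) ×-dec (s Data.Bool.≟ t))

compl≢ : ∀ l → compl l ≢ l
compl≢ (lit v false) ()
compl≢ (lit v true)  ()

≈C-refl : ∀ C → C ≈C C
≈C-refl C l = mk⇔ id id

∈⇒∈CS : ∀ {C G} → C ∈ G → C ∈CS G
∈⇒∈CS = Data.List.Relation.Unary.Any.map (λ { refl → ≈C-refl _ })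

IsClause-unique : ∀ {C} → IsClause C → ∀ {l y} → l ∈ C → y ∈ C → var l ≡ var y → l ≡ y
IsClause-unique icC {lit v false} {lit .v false} _ _ refl = refl
IsClause-unique icC {lit v true}  {lit .v true}  _ _ refl = refl
IsClause-unique icC {lit v false} {lit .v true}  l∈C y∈C refl = ⊥-elim (icC v (y∈C , l∈C))
IsClause-unique icC {lit v true}  {lit .v false} l∈C y∈C refl = ⊥-elim (icC v (l∈C , y∈C))

vars : CS → List Var
vars [] = []
vars (C ∷ G) = map var C ++ vars G

∈vars⁺ : ∀ {G C l} → C ∈ G → l ∈ C → var l ∈ vars G
∈vars⁺ {C ∷ G} (here refl) l∈C = ∈-++⁺ˡ (∈-map⁺ var l∈C)
∈vars⁺ {D ∷ G} (there C∈G) l∈C = ∈-++⁺ʳ (map var D) (∈vars⁺ C∈G l∈C)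

∈vars⇒∈var : ∀ {G v} → v ∈ vars G → v ∈var G
∈vars⇒∈var {C ∷ G} v∈ with ∈-++⁻ (map var C) v∈
... | inj₂ v∈G = there (∈vars⇒∈var v∈G)
... | inj₁ v∈C with ∈-map⁻ var v∈C
...   | lit w s , l∈C , refl = here (s , l∈C)

∈var⇒∈vars : ∀ {G v} → v ∈var G → v ∈ vars G
∈var⇒∈vars {C ∷ G} (here (s , l∈C)) = ∈vars⁺ {C ∷ G} (here refl) l∈C
∈var⇒∈vars {C ∷ G} (there v∈G) = ∈-++⁺ʳ (map var C) (∈var⇒∈vars {G} v∈G)

size : CS → ℕ
size [] = 0
size (C ∷ G) = length C + size G

-- Partial assignments are handled through their lookup functions; _*′_ is _*_ with
-- lookupPA φ unfolded, which makes composition and extensionality easy to state.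
Valuation : Set
Valuation = Var → Maybe Bool

makesTrue : Maybe Bool → Bool → Bool
makesTrue (just b) s = eqB b s
makesTrue nothing  s = false

makesFalse : Maybe Bool → Bool → Bool
makesFalse (just b) s = not (eqB b s)
makesFalse nothing  s = false

clauseSat′ : Valuation → Cl → Bool
clauseSat′ f [] = false
clauseSat′ f (lit v s ∷ C) = makesTrue (f v) s ∨ clauseSat′ f C

shorten′ : Valuation → Cl → Cl
shorten′ f [] = []
shorten′ f (lit v s ∷ C) = if makesFalse (f v) s then shorten′ f C else lit v s ∷ shorten′ f C

infixr 5 _*′_
_*′_ : Valuation → CS → CS
f *′ [] = []
f *′ (C ∷ G) = if clauseSat′ f C then f *′ G else shorten′ f C ∷ f *′ G

litTrue≡makesTrue : ∀ φ v s → litTrue φ (lit v s) ≡ makesTrue (lookupPA φ v) s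
litTrue≡makesTrue φ v s with lookupPA φ v
... | just b  = refl
... | nothing = refl

litFalse≡makesFalse : ∀ φ v s → litFalse φ (lit v s) ≡ makesFalse (lookupPA φ v) s
litFalse≡makesFalse φ v s with lookupPA φ v
... | just b  = refl
... | nothing = refl

clauseSat≡clauseSat′ : ∀ φ C → clauseSat φ C ≡ clauseSat′ (lookupPA φ) C
clauseSat≡clauseSat′ φ [] = refl
clauseSat≡clauseSat′ φ (lit v s ∷ C)
  rewrite litTrue≡makesTrue φ v s | clauseSat≡clauseSat′ φ C = refl

shorten≡shorten′ : ∀ φ C → shorten φ C ≡ shorten′ (lookupPA φ) C
shorten≡shorten′ φ [] = refl
shorten≡shorten′ φ (lit v s ∷ C)
  rewrite litFalse≡makesFalse φ v s | shorten≡shorten′ φ C = refl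

*≡*′ : ∀ φ G → φ * G ≡ lookupPA φ *′ G
*≡*′ φ [] = refl
*≡*′ φ (C ∷ G)
  rewrite clauseSat≡clauseSat′ φ C | shorten≡shorten′ φ C | *≡*′ φ G = refl

AgreeOn : Valuation → Valuation → Cl → Set
AgreeOn f g C = ∀ {l} → l ∈ C → f (var l) ≡ g (var l)

AgreeOn-∷ : ∀ {f g l C} → AgreeOn f g (l ∷ C) → AgreeOn f g C
AgreeOn-∷ agree = agree ∘ there

clauseSat′-cong : ∀ {f g} C → AgreeOn f g C → clauseSat′ f C ≡ clauseSat′ g C
clauseSat′-cong [] _ = refl
clauseSat′-cong (lit v s ∷ C) agree rewrite agree (here refl) | clauseSat′-cong C (AgreeOn-∷ agree) = refl

shorten′-cong : ∀ {f g} C → AgreeOn f g C → shorten′ f C ≡ shorten′ g C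
shorten′-cong [] _ = refl
shorten′-cong (lit v s ∷ C) agree rewrite agree (here refl) | shorten′-cong C (AgreeOn-∷ agree) = refl

*′-cong-on : ∀ {f g} G → (∀ {C} → C ∈ G → AgreeOn f g C) → f *′ G ≡ g *′ G
*′-cong-on [] _ = refl
*′-cong-on (C ∷ G) agree
  rewrite clauseSat′-cong C (agree (here refl)) | shorten′-cong C (agree (here refl))
        | *′-cong-on G (agree ∘ there) = refl

*′-cong : ∀ {f g} → f ≗ g → ∀ G → f *′ G ≡ g *′ G
*′-cong f≗g G = *′-cong-on G (λ _ {l} _ → f≗g (var l))

clauseSat′-[] : ∀ C → clauseSat′ (lookupPA []) C ≡ false
clauseSat′-[] [] = refl
clauseSat′-[] (lit v s ∷ C) = clauseSat′-[] C

shorten′-[] : ∀ C → shorten′ (lookupPA []) C ≡ C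
shorten′-[] [] = refl
shorten′-[] (lit v s ∷ C) = cong (lit v s ∷_) (shorten′-[] C)

*′-identity : ∀ G → lookupPA [] *′ G ≡ G
*′-identity [] = refl
*′-identity (C ∷ G) rewrite clauseSat′-[] C | shorten′-[] C = cong (C ∷_) (*′-identity G)

infixr 6 _▹_
_▹_ : Valuation → Valuation → Valuation
(f ▹ g) v = f v <∣> g v

lookupPA-++ : ∀ φ ψ → lookupPA (φ ++ ψ) ≗ lookupPA φ ▹ lookupPA ψ
lookupPA-++ [] ψ w = refl
lookupPA-++ ((u , b) ∷ φ) ψ w with w ≡ᵇ u
... | true  = refl
... | false = lookupPA-++ φ ψ w

▹-unsatisfied : ∀ f g C → clauseSat′ f C ≡ false →
  clauseSat′ (f ▹ g) C ≡ clauseSat′ g (shorten′ f C) × shorten′ (f ▹ g) C ≡ shorten′ g (shorten′ f C)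
▹-unsatisfied f g [] _ = refl , refl
▹-unsatisfied f g (lit v s ∷ C) e with f v | ∨-false⁻ (makesTrue (f v) s) (clauseSat′ f C) e
... | just b  | v-false , C-unsat rewrite v-false = ▹-unsatisfied f g C C-unsat
... | nothing | _ , C-unsat with g v | ▹-unsatisfied f g C C-unsat
...   | nothing | sat≡ , shorten≡ = sat≡ , cong (lit v s ∷_) shorten≡
...   | just c  | sat≡ , shorten≡ with eqB c s
...     | false = sat≡ , shorten≡
...     | true  = cong (true ∨_) sat≡ , cong (lit v s ∷_) shorten≡

▹-satisfied : ∀ f g C → clauseSat′ f C ≡ true → clauseSat′ (f ▹ g) C ≡ true
▹-satisfied f g (lit v s ∷ C) e with f v
... | nothing rewrite ▹-satisfied f g C e = ∨-zeroʳ (makesTrue (g v) s)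
... | just b with eqB b s
...   | true  = refl
...   | false = ▹-satisfied f g C e

*′-▹ : ∀ f g G → g *′ (f *′ G) ≡ (f ▹ g) *′ G
*′-▹ f g [] = refl
*′-▹ f g (C ∷ G) with clauseSat′ f C in e
... | true rewrite ▹-satisfied f g C e = *′-▹ f g G
... | false with ▹-unsatisfied f g C e
...   | sat≡ , shorten≡ rewrite sat≡ | shorten≡ with clauseSat′ g (shorten′ f C)
...     | true  = *′-▹ f g G
...     | false = cong (shorten′ g (shorten′ f C) ∷_) (*′-▹ f g G)

single : Var → Bool → Valuation
single v ε = lookupPA ⟨ v ↦ ε ⟩

single-self : ∀ v ε → single v ε v ≡ just ε
single-self v ε rewrite ≡ᵇ-refl v = refl

single-other : ∀ v ε w → w ≢ v → single v ε w ≡ nothing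
single-other v ε w w≢v rewrite ≢⇒≡ᵇ-false w v w≢v = refl

*′-single-comm : ∀ f v ε G → f v ≡ nothing → single v ε *′ f *′ G ≡ f *′ single v ε *′ G
*′-single-comm f v ε G fv≡nothing = begin
  single v ε *′ f *′ G   ≡⟨ *′-▹ f (single v ε) G ⟩
  (f ▹ single v ε) *′ G  ≡⟨ *′-cong ▹-comm G ⟩
  (single v ε ▹ f) *′ G  ≡⟨ *′-▹ (single v ε) f G ⟨
  f *′ single v ε *′ G   ∎
  where
  open ≡-Reasoning
  ▹-comm : f ▹ single v ε ≗ single v ε ▹ f
  ▹-comm w with w ≡ᵇ v in w≡ᵇv
  ... | true rewrite ≡ᵇ-true⇒≡ w v w≡ᵇv | fv≡nothing = refl
  ... | false with f w
  ...   | just _  = refl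
  ...   | nothing = refl

*′-single-absorb : ∀ f v ε G → f v ≡ just ε → f *′ single v ε *′ G ≡ f *′ G
*′-single-absorb f v ε G fv≡ε = trans (*′-▹ (single v ε) f G) (*′-cong absorb G)
  where
  absorb : single v ε ▹ f ≗ f
  absorb w with w ≡ᵇ v in w≡ᵇv
  ... | true rewrite ≡ᵇ-true⇒≡ w v w≡ᵇv = sym fv≡ε
  ... | false = refl

*′-∷ : ∀ v ε φ G → lookupPA ((v , ε) ∷ φ) *′ G ≡ lookupPA φ *′ single v ε *′ G
*′-∷ v ε φ G = trans (*′-cong (lookupPA-++ ⟨ v ↦ ε ⟩ φ) G) (sym (*′-▹ (single v ε) (lookupPA φ) G))

⊥∈-*′ : ∀ f {G} → [] ∈ G → [] ∈ f *′ G
⊥∈-*′ f {C ∷ G} (here refl) = here refl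
⊥∈-*′ f {C ∷ G} (there ⊥∈G) with clauseSat′ f C
... | true  = ⊥∈-*′ f ⊥∈G
... | false = there (⊥∈-*′ f ⊥∈G)

∈-*′⁻ : ∀ {Q : Cl → Set} g G → Any Q (g *′ G) → Any (λ C → clauseSat′ g C ≡ false × Q (shorten′ g C)) G
∈-*′⁻ g (C ∷ G) q with clauseSat′ g C in e
... | true = there (∈-*′⁻ g G q)
∈-*′⁻ g (C ∷ G) (here qC) | false = here (e , qC)
∈-*′⁻ g (C ∷ G) (there q) | false = there (∈-*′⁻ g G q)

∈-shorten′⁻ : ∀ g {C l} → l ∈ shorten′ g C → l ∈ C × makesFalse (g (var l)) (sign l) ≡ false
∈-shorten′⁻ g {lit v s ∷ C} l∈ with makesFalse (g v) s in e
... | true = Data.Product.map₁ there (∈-shorten′⁻ g l∈)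
∈-shorten′⁻ g {lit v s ∷ C} (here refl) | false = here refl , e
∈-shorten′⁻ g {lit v s ∷ C} (there l∈) | false = Data.Product.map₁ there (∈-shorten′⁻ g l∈)

∈-shorten′⁺ : ∀ g {C l} → l ∈ C → makesFalse (g (var l)) (sign l) ≡ false → l ∈ shorten′ g C
∈-shorten′⁺ g {lit v s ∷ C} (here refl) e rewrite e = here refl
∈-shorten′⁺ g {lit v s ∷ C} (there l∈) e with makesFalse (g v) s
... | true  = ∈-shorten′⁺ g l∈ e
... | false = there (∈-shorten′⁺ g l∈ e)

unsatisfied-literal : ∀ g {C l} → clauseSat′ g C ≡ false → l ∈ C → makesTrue (g (var l)) (sign l) ≡ false
unsatisfied-literal g {lit v s ∷ C} e (here refl) = proj₁ (∨-false⁻ _ _ e)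
unsatisfied-literal g {lit v s ∷ C} e (there l∈) = unsatisfied-literal g (proj₂ (∨-false⁻ _ _ e)) l∈

∈-shorten′-single : ∀ v ε {C l} → clauseSat′ (single v ε) C ≡ false → l ∈ C →
                    l ∈ shorten′ (single v ε) C ⊎ l ≡ lit v (not ε)
∈-shorten′-single v ε {l = lit w s} unsat l∈C with w Data.Nat.≟ v
... | no w≢v = inj₁ (∈-shorten′⁺ (single v ε) l∈C (cong (λ m → makesFalse m s) (single-other v ε w w≢v)))
... | yes refl with unsatisfied-literal (single v ε) unsat l∈C
...   | ε≠s rewrite single-self w ε = inj₂ (cong (lit w) (opposite ε s ε≠s))
  where
  opposite : ∀ ε s → eqB ε s ≡ false → s ≡ not ε
  opposite false true  _ = refl
  opposite true  false _ = refl

shorten′-single-avoids : ∀ v ε {C l} → clauseSat′ (single v ε) C ≡ false →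
                         l ∈ shorten′ (single v ε) C → var l ≢ v
shorten′-single-avoids v ε {C} {lit w s} unsat l∈ refl with ∈-shorten′⁻ (single v ε) {C} l∈
... | l∈C , kept with unsatisfied-literal (single v ε) unsat l∈C
...   | unsatisfied rewrite single-self w ε = neither-true-nor-false ε s unsatisfied kept
  where
  neither-true-nor-false : ∀ ε s → eqB ε s ≡ false → not (eqB ε s) ≢ false
  neither-true-nor-false false true  _ ()
  neither-true-nor-false true  false _ ()

∉var⇒*′-single : ∀ v ε G → ¬ v ∈var G → single v ε *′ G ≡ G
∉var⇒*′-single v ε G v∉G = trans (*′-cong-on G agree) (*′-identity G)
  where
  agree : ∀ {C} → C ∈ G → AgreeOn (single v ε) (lookupPA []) C
  agree C∈G {lit w s} l∈C = single-other v ε w λ { refl → v∉G (lose C∈G (s , l∈C)) }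

length-shorten′ : ∀ g C → length (shorten′ g C) ≤ length C
length-shorten′ g [] = z≤n
length-shorten′ g (lit v s ∷ C) with makesFalse (g v) s
... | true  = m≤n⇒m≤1+n (length-shorten′ g C)
... | false = s≤s (length-shorten′ g C)

length-shorten′-< : ∀ g {C l} → l ∈ C → makesFalse (g (var l)) (sign l) ≡ true → length (shorten′ g C) < length C
length-shorten′-< g {lit v s ∷ C} (here refl) falsl rewrite falsl = s≤s (length-shorten′ g C)
length-shorten′-< g {lit v s ∷ C} (there l∈C) falsl with makesFalse (g v) s
... | true  = m≤n⇒m≤1+n (length-shorten′-< g l∈C falsl)
... | false = s≤s (length-shorten′-< g l∈C falsl)

size-*′ : ∀ f G → size (f *′ G) ≤ size G
size-*′ f [] = z≤n
size-*′ f (C ∷ G) with clauseSat′ f C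
... | true  = m≤n⇒m≤o+n (length C) (size-*′ f G)
... | false = +-mono-≤ (length-shorten′ f C) (size-*′ f G)

size-*′-single : ∀ v ε G → v ∈var G → size (single v ε *′ G) < size G
size-*′-single v ε (C ∷ G) (here (s , l∈C)) with clauseSat′ (single v ε) C in sat
... | true  = <-≤-trans (s≤s (size-*′ (single v ε) G)) (+-monoˡ-≤ (size G) (∈-length l∈C))
... | false = +-mono-<-≤ (length-shorten′-< (single v ε) l∈C falsified) (size-*′ (single v ε) G)
  where
  falsified : makesFalse (single v ε v) s ≡ true
  falsified with unsatisfied-literal (single v ε) sat l∈C
  ... | unsatisfied rewrite single-self v ε | unsatisfied = refl
size-*′-single v ε (C ∷ G) (there v∈G) with clauseSat′ (single v ε) C
... | true  = ≤-trans (size-*′-single v ε G v∈G) (m≤n+m (size G) (length C))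
... | false = +-mono-≤-< (length-shorten′ (single v ε) C) (size-*′-single v ε G v∈G)

IsClauseSet-*′ : ∀ f {G} → IsClauseSet G → IsClauseSet (f *′ G)
IsClauseSet-*′ f {[]} [] = []
IsClauseSet-*′ f {C ∷ G} (icC ∷ icG) with clauseSat′ f C
... | true  = IsClauseSet-*′ f icG
... | false = shortened ∷ IsClauseSet-*′ f icG
  where
  shortened : IsClause (shorten′ f C)
  shortened v (pos , neg) = icC v (proj₁ (∈-shorten′⁻ f pos) , proj₁ (∈-shorten′⁻ f neg))

IsClauseSet-* : ∀ φ {G} → IsClauseSet G → IsClauseSet (φ * G)
IsClauseSet-* φ {G} icG = subst IsClauseSet (sym (*≡*′ φ G)) (IsClauseSet-*′ (lookupPA φ) icG)

Falsifies : Valuation → Cl → Set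
Falsifies f C = ∀ l → l ∈ C → makesFalse (f (var l)) (sign l) ≡ true

makesFalse-≢ : ∀ {m b s} → m ≡ just b → b ≢ s → makesFalse m s ≡ true
makesFalse-≢ {b = false} {false} refl b≢s = ⊥-elim (b≢s refl)
makesFalse-≢ {b = false} {true}  refl _   = refl
makesFalse-≢ {b = true}  {false} refl _   = refl
makesFalse-≢ {b = true}  {true}  refl b≢s = ⊥-elim (b≢s refl)

Falsifies-▹ : ∀ f g {C} → Falsifies f C → Falsifies (f ▹ g) C
Falsifies-▹ f g falsC l l∈C with f (var l) | falsC l l∈C
... | just b | falsl = falsl

falsified-clause : ∀ f C → Falsifies f C → clauseSat′ f C ≡ false × shorten′ f C ≡ []
falsified-clause f [] _ = refl , refl
falsified-clause f (lit v s ∷ C) falsC with f v | falsC (lit v s) (here refl)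
... | just b | falsl with eqB b s
...   | false = falsified-clause f C (λ l l∈C → falsC l (there l∈C))

falsified-leaf : ∀ f {C G} → C ∈CS G → Falsifies f C → [] ∈ f *′ G
falsified-leaf f {G = D ∷ G} (here C≈D) falsC
  with falsified-clause f D (λ l l∈D → falsC l (Equivalence.from (C≈D l) l∈D))
... | unsat , shortened rewrite unsat | shortened = here refl
falsified-leaf f {G = D ∷ G} (there C∈G) falsC with clauseSat′ f D
... | true  = falsified-leaf f C∈G falsC
... | false = there (falsified-leaf f C∈G falsC)

falsifier : Cl → PA
falsifier = map λ l → var l , not (sign l)

falsifier-falsifies : ∀ {C} → IsClause C → Falsifies (lookupPA (falsifier C)) C
falsifier-falsifies {l ∷ C} icC l′ l′∈ with var l′ Data.Nat.≟ var l
... | yes l′~l rewrite IsClause-unique icC l′∈ (here refl) l′~l | ≡ᵇ-refl (var l) =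
  makesFalse-≢ refl (not-¬ refl ∘ sym)
... | no  l′≁l rewrite ≢⇒≡ᵇ-false _ _ l′≁l =
  falsifier-falsifies (λ v (pos , neg) → icC v (there pos , there neg)) l′ (tail (l′≁l ∘ cong var) l′∈)

-- hts (node R T₁ T₂) reduces to strahler (hts T₁) (hts T₂).
strahler : ℕ → ℕ → ℕ
strahler h₁ h₂ = if h₁ ≡ᵇ h₂ then suc h₁ else h₁ ⊔ h₂

strahler-≡ : ∀ h → strahler h h ≡ suc h
strahler-≡ h rewrite ≡ᵇ-refl h = refl

strahler-< : ∀ {h₁ h₂} → h₁ < h₂ → strahler h₁ h₂ ≡ h₂
strahler-< {h₁} {h₂} h₁<h₂ rewrite ≢⇒≡ᵇ-false h₁ h₂ (<⇒≢ h₁<h₂) = m≤n⇒m⊔n≡n (<⇒≤ h₁<h₂)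

strahler-> : ∀ {h₁ h₂} → h₂ < h₁ → strahler h₁ h₂ ≡ h₁
strahler-> {h₁} {h₂} h₂<h₁ rewrite ≢⇒≡ᵇ-false h₁ h₂ (>⇒≢ h₂<h₁) = m≥n⇒m⊔n≡m (<⇒≤ h₂<h₁)

⊔≤strahler : ∀ h₁ h₂ → h₁ ⊔ h₂ ≤ strahler h₁ h₂
⊔≤strahler h₁ h₂ with h₁ ≡ᵇ h₂ in e
... | false = ≤-refl
... | true rewrite ≡ᵇ-true⇒≡ h₁ h₂ e | ⊔-idem h₂ = n≤1+n h₂

strahler-≤ : ∀ {h₁ h₂ k} → h₁ ≤ k → h₂ ≤ suc k → strahler h₁ h₂ ≤ suc k
strahler-≤ {h₁} {h₂} {k} h₁≤k h₂≤1+k with <-cmp h₁ h₂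
... | tri< h₁<h₂ _ _   rewrite strahler-< h₁<h₂ = h₂≤1+k
... | tri≈ _ refl _    rewrite strahler-≡ h₁ = s≤s h₁≤k
... | tri> _ _ h₂<h₁   rewrite strahler-> h₂<h₁ = m≤n⇒m≤1+n h₁≤k

strahler-squeeze : ∀ {a b₀ b₁ c₀ c₁} → b₀ ≤ a → b₁ ≤ a → c₀ ≤ b₀ → c₁ ≤ b₁ → a ≤ strahler c₀ c₁ →
                   b₀ ≡ a ⊎ b₁ ≡ a ⊎ (b₁ ≡ b₀ × suc b₀ ≡ a)
strahler-squeeze {a} {b₀} {b₁} {c₀} {c₁} b₀≤a b₁≤a c₀≤b₀ c₁≤b₁ a≤s
  with b₀ Data.Nat.≟ a | b₁ Data.Nat.≟ a
... | yes b₀≡a | _        = inj₁ b₀≡a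
... | no _     | yes b₁≡a = inj₂ (inj₁ b₁≡a)
... | no b₀≢a  | no b₁≢a with <-cmp c₀ c₁
...   | tri< c₀<c₁ _ _ = ⊥-elim (b₁≢a (≤-antisym b₁≤a (≤-trans (subst (a ≤_) (strahler-< c₀<c₁) a≤s) c₁≤b₁)))
...   | tri> _ _ c₁<c₀ = ⊥-elim (b₀≢a (≤-antisym b₀≤a (≤-trans (subst (a ≤_) (strahler-> c₁<c₀) a≤s) c₀≤b₀)))
...   | tri≈ _ refl _  = inj₂ (inj₂ (trans b₁≡c₀ (sym b₀≡c₀) , ≤-antisym b₀<a (subst (a ≤_) (cong suc (sym b₀≡c₀)) a≤1+c₀)))
  where
  a≤1+c₀ : a ≤ suc c₀
  a≤1+c₀ = subst (a ≤_) (strahler-≡ c₀) a≤s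
  b₀<a : b₀ < a
  b₀<a = ≤∧≢⇒< b₀≤a b₀≢a
  b₀≡c₀ : b₀ ≡ c₀
  b₀≡c₀ = ≤-antisym (≤-pred (≤-trans b₀<a a≤1+c₀)) c₀≤b₀
  b₁≡c₀ : b₁ ≡ c₀
  b₁≡c₀ = ≤-antisym (≤-pred (≤-trans (≤∧≢⇒< b₁≤a b₁≢a) a≤1+c₀)) c₁≤b₁

-- The splitting characterisation of hd(G) ≤ k.
data Hd≤ : CS → ℕ → Set where
  ⊥∈    : ∀ {G k} → [] ∈ G → Hd≤ G k
  split : ∀ {G k} v ε → Hd≤ (single v ε *′ G) k → Hd≤ (single v (not ε) *′ G) (suc k) → Hd≤ G (suc k)

Hd≤-mono : ∀ {G k k′} → Hd≤ G k → k ≤ k′ → Hd≤ G k′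
Hd≤-mono (⊥∈ ⊥∈G) _ = ⊥∈ ⊥∈G
Hd≤-mono (split v ε d₁ d₂) (s≤s k≤k′) = split v ε (Hd≤-mono d₁ k≤k′) (Hd≤-mono d₂ (s≤s k≤k′))

Hd≤-*′ : ∀ {G k} → Hd≤ G k → ∀ f → Hd≤ (f *′ G) k
Hd≤-*′ (⊥∈ ⊥∈G) f = ⊥∈ (⊥∈-*′ f ⊥∈G)
Hd≤-*′ {G} (split v ε d₁ d₂) f with f v in fv≡
... | nothing = split v ε (subst (flip Hd≤ _) (sym (*′-single-comm f v ε G fv≡)) (Hd≤-*′ d₁ f))
                          (subst (flip Hd≤ _) (sym (*′-single-comm f v (not ε) G fv≡)) (Hd≤-*′ d₂ f))
... | just b with b Data.Bool.≟ ε
...   | yes refl = Hd≤-mono (subst (flip Hd≤ _) (*′-single-absorb f v b G fv≡) (Hd≤-*′ d₁ f)) (n≤1+n _)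
...   | no b≢ε   =
  subst (flip Hd≤ _) (*′-single-absorb f v (not ε) G (trans fv≡ (cong just (¬-not b≢ε)))) (Hd≤-*′ d₂ f)

Hd≤-⊤ : ∀ {k} → ¬ Hd≤ [] k
Hd≤-⊤ (⊥∈ ())
Hd≤-⊤ (split v ε d₁ d₂) = Hd≤-⊤ d₁

Hd≤⇒unsat′ : ∀ {G k} → Hd≤ G k → ∀ f → f *′ G ≢ []
Hd≤⇒unsat′ d f f*G≡[] = Hd≤-⊤ (subst (flip Hd≤ _) f*G≡[] (Hd≤-*′ d f))

Hd≤⇒Unsat : ∀ {G k} → Hd≤ G k → Unsat G
Hd≤⇒Unsat {G} d (φ , φ*G≡[]) = Hd≤⇒unsat′ d (lookupPA φ) (trans (sym (*≡*′ φ G)) φ*G≡[])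

Hd≤-split : ∀ G v ε {h₁ h₂} → Hd≤ (single v ε *′ G) h₁ → Hd≤ (single v (not ε) *′ G) h₂ →
            Hd≤ G (strahler h₁ h₂)
Hd≤-split G v ε {h₁} {h₂} d₁ d₂ with <-cmp h₁ h₂
... | tri≈ _ refl _ rewrite strahler-≡ h₁ = split v ε d₁ (Hd≤-mono d₂ (n≤1+n h₁))
Hd≤-split G v ε {h₁} {suc h₂} d₁ d₂ | tri< (s≤s h₁≤h₂) _ _
  rewrite strahler-< {h₁} {suc h₂} (s≤s h₁≤h₂) = split v ε (Hd≤-mono d₁ h₁≤h₂) d₂
Hd≤-split G v ε {suc h₁} {h₂} d₁ d₂ | tri> _ _ (s≤s h₂≤h₁)
  rewrite strahler-> {suc h₁} {h₂} (s≤s h₂≤h₁) =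
  split v (not ε) (Hd≤-mono d₂ h₂≤h₁)
        (subst (λ ε′ → Hd≤ (single v ε′ *′ G) (suc h₁)) (sym (not-involutive ε)) d₁)

Satisfiable′ : CS → Set
Satisfiable′ G = Σ PA λ φ → lookupPA φ *′ G ≡ []

-- DPLL: splitting on a variable of the first clause strictly decreases the size.
dpll : ∀ n G → size G ≤ n → Hd≤ G (size G) ⊎ Satisfiable′ G
dpll n [] _ = inj₂ ([] , refl)
dpll n ([] ∷ G) _ = inj₁ (⊥∈ (here refl))
dpll (suc n) G@((l ∷ C) ∷ _) size≤ = combine (dpll n _ (fuel false)) (dpll n _ (fuel true))
  where
  smaller : ∀ ε → size (single (var l) ε *′ G) < size G
  smaller ε = size-*′-single (var l) ε G (here (sign l , here refl))
  fuel : ∀ ε → size (single (var l) ε *′ G) ≤ n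
  fuel ε = ≤-pred (≤-trans (smaller ε) size≤)
  extend : ∀ ε → Satisfiable′ (single (var l) ε *′ G) → Satisfiable′ G
  extend ε (φ , φ*≡[]) = (var l , ε) ∷ φ , trans (*′-∷ (var l) ε φ G) φ*≡[]
  Result : Bool → Set
  Result ε = Hd≤ (single (var l) ε *′ G) (size (single (var l) ε *′ G)) ⊎ Satisfiable′ (single (var l) ε *′ G)
  combine : Result false → Result true → Hd≤ G (size G) ⊎ Satisfiable′ G
  combine (inj₂ sat)           _          = inj₂ (extend false sat)
  combine (inj₁ _)             (inj₂ sat) = inj₂ (extend true sat)
  combine (inj₁ d₀)            (inj₁ d₁)  =
    inj₁ (split (var l) false (Hd≤-mono d₀ (≤-pred (smaller false))) (Hd≤-mono d₁ (<⇒≤ (smaller true))))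

Hd≤-size : ∀ {G k} → Hd≤ G k → Hd≤ G (size G)
Hd≤-size {G} d with dpll (size G) G ≤-refl
... | inj₁ d′ = d′
... | inj₂ (φ , φ*G≡[]) = ⊥-elim (Hd≤⇒unsat′ d (lookupPA φ) φ*G≡[])

SplitsOn : CS → ℕ → Var → Set
SplitsOn G k v = Σ Bool λ ε → Hd≤ (single v ε *′ G) k × Hd≤ (single v (not ε) *′ G) (suc k)

Hd≤-Normal : CS → ℕ → Set
Hd≤-Normal G zero    = [] ∈ G
Hd≤-Normal G (suc k) = [] ∈ G ⊎ Any (SplitsOn G k) (vars G)

Hd≤-Normal-suc : ∀ G k → Hd≤-Normal G k → Hd≤-Normal G (suc k)
Hd≤-Normal-suc G zero ⊥∈G = inj₁ ⊥∈G
Hd≤-Normal-suc G (suc k) (inj₁ ⊥∈G) = inj₁ ⊥∈G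
Hd≤-Normal-suc G (suc k) (inj₂ splits) =
  inj₂ (Data.List.Relation.Unary.Any.map
         (λ (ε , d₁ , d₂) → ε , Hd≤-mono d₁ (n≤1+n k) , Hd≤-mono d₂ (n≤1+n (suc k))) splits)

Hd≤-normal : ∀ {G k} → Hd≤ G k → Hd≤-Normal G k
Hd≤-normal {k = zero}  (⊥∈ ⊥∈G) = ⊥∈G
Hd≤-normal {k = suc k} (⊥∈ ⊥∈G) = inj₁ ⊥∈G
Hd≤-normal {G} {suc k} (split v ε d₁ d₂) with any? (v Data.Nat.≟_) (vars G)
... | yes v∈G = inj₂ (lose v∈G (ε , d₁ , d₂))
... | no  v∉G =
  Hd≤-Normal-suc G k (subst (flip Hd≤-Normal k) (∉var⇒*′-single v ε G (v∉G ∘ ∈var⇒∈vars)) (Hd≤-normal d₁))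

Hd≤-Normal⇒Hd≤ : ∀ {G} k → Hd≤-Normal G k → Hd≤ G k
Hd≤-Normal⇒Hd≤ zero ⊥∈G = ⊥∈ ⊥∈G
Hd≤-Normal⇒Hd≤ (suc k) (inj₁ ⊥∈G) = ⊥∈ ⊥∈G
Hd≤-Normal⇒Hd≤ (suc k) (inj₂ splits) with satisfied splits
... | v , ε , d₁ , d₂ = split v ε d₁ d₂

⊥∈? : ∀ G → Dec ([] ∈ G)
⊥∈? = any? ([] ≟C_)
  where
  _≟C_ : DecidableEquality Cl
  _≟C_ = ≡-dec _≟L_

mutual
  Hd≤? : ∀ n G → size G ≤ n → ∀ k → Dec (Hd≤ G k)
  Hd≤? n G size≤ k = map′ (Hd≤-Normal⇒Hd≤ k) Hd≤-normal (Normal? k)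
    where
    SplitsOn? : ∀ j {v} → v ∈ vars G → Dec (SplitsOn G j v)
    SplitsOn? j v∈ = Σ-Bool? (Hd≤-single? n G size≤ v∈ false j ×-dec Hd≤-single? n G size≤ v∈ true (suc j))
                             (Hd≤-single? n G size≤ v∈ true j ×-dec Hd≤-single? n G size≤ v∈ false (suc j))
    Normal? : ∀ j → Dec (Hd≤-Normal G j)
    Normal? zero    = ⊥∈? G
    Normal? (suc j) = ⊥∈? G ⊎-dec any?-∈ (vars G) (SplitsOn? j)

  Hd≤-single? : ∀ n G → size G ≤ n → ∀ {v} → v ∈ vars G → ∀ ε j → Dec (Hd≤ (single v ε *′ G) j)
  Hd≤-single? zero G size≤ v∈ ε j = ⊥-elim (n≮0 (<-≤-trans (size-*′-single _ ε G (∈vars⇒∈var v∈)) size≤))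
  Hd≤-single? (suc n) G size≤ v∈ ε j =
    Hd≤? n _ (≤-pred (<-≤-trans (size-*′-single _ ε G (∈vars⇒∈var v∈)) size≤)) j

label-IsClause : ∀ {G} → IsClauseSet G → ∀ T → ValidTree T → LeavesIn G T → IsClause (label T)
label-IsClause icG (leaf C) _ C∈G v (pos , neg) with lookupAny icG C∈G
... | icD , C≈D = icD v (Equivalence.to (C≈D _) pos , Equivalence.to (C≈D _) neg)
label-IsClause icG (node R T₁ T₂) (valid₁ , valid₂ , (x , _ , _ , unique , R≈)) (in₁ , in₂) v (pos , neg)
  with Equivalence.to (R≈ _) pos | Equivalence.to (R≈ _) neg
... | inj₁ p , _    | inj₁ n , _ = label-IsClause icG T₁ valid₁ in₁ v (p , n)
... | inj₂ p , _    | inj₂ n , _ = label-IsClause icG T₂ valid₂ in₂ v (p , n)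
... | inj₁ p , p≢x  | inj₂ n , _ = p≢x (cong var (unique _ p n))
... | inj₂ p , p≢x  | inj₁ n , _ = p≢x (cong var (unique _ n p))

falsifies-premise : ∀ f {C R y} → IsClause C → y ∈ C → (∀ l → l ∈ C → var l ≢ var y → l ∈ R) →
                    makesFalse (f (var y)) (sign y) ≡ true → Falsifies f R → Falsifies f C
falsifies-premise f {y = y} icC y∈C C⊆R falsy falsR l l∈C with var l Data.Nat.≟ var y
... | yes l~y rewrite IsClause-unique icC l∈C y∈C l~y = falsy
... | no  l≁y = falsR l (C⊆R l l∈C l≁y)

-- Carry an assignment falsifying the label down the tree: at a node resolving on x, split
-- on x if f leaves it open, otherwise descend into the premise that f falsifies.
tree⇒Hd≤ : ∀ {G} → IsClauseSet G → ∀ T → ValidTree T → LeavesIn G T →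
           ∀ f → Falsifies f (label T) → Hd≤ (f *′ G) (hts T)
tree⇒Hd≤ icG (leaf C) _ C∈G f falsC = ⊥∈ (falsified-leaf f C∈G falsC)
tree⇒Hd≤ {G} icG (node R T₁ T₂) (valid₁ , valid₂ , (x , x∈C₁ , x̄∈C₂ , _ , R≈)) (in₁ , in₂) f falsR =
  by-value-of-x (f (var x)) refl
  where
  left : ∀ f′ → makesFalse (f′ (var x)) (sign x) ≡ true → Falsifies f′ R → Hd≤ (f′ *′ G) (hts T₁)
  left f′ falsx falsR′ = tree⇒Hd≤ icG T₁ valid₁ in₁ f′
    (falsifies-premise f′ (label-IsClause icG T₁ valid₁ in₁) x∈C₁
      (λ l l∈ l≁x → Equivalence.from (R≈ l) (inj₁ l∈ , l≁x)) falsx falsR′)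
  right : ∀ f′ → makesFalse (f′ (var x)) (not (sign x)) ≡ true → Falsifies f′ R → Hd≤ (f′ *′ G) (hts T₂)
  right f′ falsx̄ falsR′ = tree⇒Hd≤ icG T₂ valid₂ in₂ f′
    (falsifies-premise f′ (label-IsClause icG T₂ valid₂ in₂) x̄∈C₂
      (λ l l∈ l≁x → Equivalence.from (R≈ l) (inj₂ l∈ , l≁x)) falsx̄ falsR′)
  extend : Bool → Valuation
  extend ε = f ▹ single (var x) ε
  extend-at-x : ∀ ε → f (var x) ≡ nothing → extend ε (var x) ≡ just ε
  extend-at-x ε fx rewrite fx = single-self (var x) ε
  by-value-of-x : ∀ m → f (var x) ≡ m → Hd≤ (f *′ G) (strahler (hts T₁) (hts T₂))
  by-value-of-x nothing fx = Hd≤-split (f *′ G) (var x) (not (sign x))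
    (subst (flip Hd≤ _) (sym (*′-▹ f _ G))
      (left (extend (not (sign x)))
        (makesFalse-≢ (extend-at-x _ fx) (not-¬ refl ∘ sym))
        (Falsifies-▹ f _ falsR)))
    (subst (flip Hd≤ _) (trans (sym (*′-▹ f _ G)) (cong (λ ε → single (var x) ε *′ f *′ G) (sym (not-involutive (sign x)))))
      (right (extend (sign x))
        (makesFalse-≢ (extend-at-x _ fx) (not-¬ refl))
        (Falsifies-▹ f _ falsR)))
  by-value-of-x (just b) fx with b Data.Bool.≟ sign x
  ... | yes refl = Hd≤-mono (right f (makesFalse-≢ fx (not-¬ refl)) falsR)
                            (≤-trans (m≤n⊔m (hts T₁) (hts T₂)) (⊔≤strahler (hts T₁) (hts T₂)))
  ... | no b≢x   = Hd≤-mono (left f (makesFalse-≢ fx b≢x) falsR)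
                            (≤-trans (m≤m⊔n (hts T₁) (hts T₂)) (⊔≤strahler (hts T₁) (hts T₂)))

Extends : Lit → Bool → Cl → Cl → Set
Extends x b D C = ∀ l → l ∈ C ⇔ (l ∈ D ⊎ (l ≡ x × b ≡ true))

addIf : Bool → Lit → Cl → Cl
addIf b x R = if b then x ∷ R else R

Extends-addIf : ∀ x b R → Extends x b R (addIf b x R)
Extends-addIf x false R l = mk⇔ inj₁ λ { (inj₁ l∈R) → l∈R ; (inj₂ (_ , ())) }
Extends-addIf x true  R l = mk⇔ (λ { (here refl) → inj₂ (refl , refl) ; (there l∈R) → inj₁ l∈R })
                                 λ { (inj₁ l∈R) → there l∈R ; (inj₂ (refl , _)) → here refl }

Extends-⊥ : ∀ {x C} → Extends x false [] C → C ≡ []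
Extends-⊥ {C = []} _ = refl
Extends-⊥ {C = l ∷ C} ext with Equivalence.to (ext l) (here refl)
... | inj₁ ()
... | inj₂ (_ , ())

Resolvent-Extends : ∀ {C₁ C₂ R C₁* C₂* b₁ b₂} y →
  (∀ l → l ∈ C₁ → var l ≢ var y) → (∀ l → l ∈ C₂ → var l ≢ var y) →
  Extends y b₁ C₁ C₁* → Extends y b₂ C₂ C₂* →
  Resolvent C₁ C₂ R → Resolvent C₁* C₂* (addIf (b₁ ∨ b₂) y R)
Resolvent-Extends {C₁} {C₂} {R} {C₁*} {C₂*} {b₁} {b₂} y avoid₁ avoid₂ ext₁ ext₂ (x , x∈ , x̄∈ , unique , R≈) =
  x , from (ext₁ x) (inj₁ x∈) , from (ext₂ (compl x)) (inj₁ x̄∈) , unique* , R*≈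
  where
  open Equivalence
  x≁y : var x ≢ var y
  x≁y = avoid₁ x x∈
  unique* : ∀ l → l ∈ C₁* → compl l ∈ C₂* → l ≡ x
  unique* l l∈ l̄∈ with to (ext₁ l) l∈ | to (ext₂ (compl l)) l̄∈
  ... | inj₁ l∈C₁       | inj₁ l̄∈C₂      = unique l l∈C₁ l̄∈C₂
  ... | inj₁ l∈C₁       | inj₂ (l̄≡y , _) = ⊥-elim (avoid₁ l l∈C₁ (cong var l̄≡y))
  ... | inj₂ (refl , _) | inj₁ l̄∈C₂      = ⊥-elim (avoid₂ (compl y) l̄∈C₂ refl)
  ... | inj₂ (refl , _) | inj₂ (l̄≡y , _) = ⊥-elim (compl≢ y l̄≡y)
  R*≈ : ∀ l → l ∈ addIf (b₁ ∨ b₂) y R ⇔ ((l ∈ C₁* ⊎ l ∈ C₂*) × var l ≢ var x)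
  R*≈ l = mk⇔ forth back
    where
    forth : l ∈ addIf (b₁ ∨ b₂) y R → (l ∈ C₁* ⊎ l ∈ C₂*) × var l ≢ var x
    forth l∈ with to (Extends-addIf y (b₁ ∨ b₂) R l) l∈
    ... | inj₁ l∈R with to (R≈ l) l∈R
    ...   | inj₁ l∈C₁ , l≁x = inj₁ (from (ext₁ l) (inj₁ l∈C₁)) , l≁x
    ...   | inj₂ l∈C₂ , l≁x = inj₂ (from (ext₂ l) (inj₁ l∈C₂)) , l≁x
    forth l∈ | inj₂ (refl , b₁∨b₂) with ∨-true⁻ b₁ b₂ b₁∨b₂
    ... | inj₁ b₁≡true = inj₁ (from (ext₁ y) (inj₂ (refl , b₁≡true))) , x≁y ∘ sym
    ... | inj₂ b₂≡true = inj₂ (from (ext₂ y) (inj₂ (refl , b₂≡true))) , x≁y ∘ sym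
    back : (l ∈ C₁* ⊎ l ∈ C₂*) × var l ≢ var x → l ∈ addIf (b₁ ∨ b₂) y R
    back (l∈ , l≁x) = from (Extends-addIf y (b₁ ∨ b₂) R l) (from-premise l∈)
      where
      from-premise : l ∈ C₁* ⊎ l ∈ C₂* → l ∈ R ⊎ (l ≡ y × b₁ ∨ b₂ ≡ true)
      from-premise (inj₁ l∈) with to (ext₁ l) l∈
      ... | inj₁ l∈C₁ = inj₁ (from (R≈ l) (inj₁ l∈C₁ , l≁x))
      ... | inj₂ (l≡y , b₁≡true) rewrite b₁≡true = inj₂ (l≡y , refl)
      from-premise (inj₂ l∈) with to (ext₂ l) l∈
      ... | inj₁ l∈C₂ = inj₁ (from (R≈ l) (inj₂ l∈C₂ , l≁x))
      ... | inj₂ (l≡y , b₂≡true) rewrite b₂≡true = inj₂ (l≡y , ∨-zeroʳ b₁)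

unit-resolvent : ∀ {y C D} → Extends y true [] C → Extends (compl y) true [] D → Resolvent C D []
unit-resolvent {y} e₁ e₂ =
  y , from (e₁ y) (inj₂ (refl , refl)) , from (e₂ (compl y)) (inj₂ (refl , refl)) , unique , ⊥≈
  where
  open Equivalence
  unique : ∀ l → l ∈ _ → compl l ∈ _ → l ≡ y
  unique l l∈C _ with to (e₁ l) l∈C
  ... | inj₂ (l≡y , _) = l≡y
  ⊥≈ : ∀ l → l ∈ [] ⇔ ((l ∈ _ ⊎ l ∈ _) × var l ≢ var y)
  ⊥≈ l = mk⇔ (λ ()) λ where
    (inj₁ l∈C , l≁y) → case to (e₁ l) l∈C of λ { (inj₂ (refl , _)) → ⊥-elim (l≁y refl) }
    (inj₂ l∈D , l≁y) → case to (e₂ l) l∈D of λ { (inj₂ (refl , _)) → ⊥-elim (l≁y refl) }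

label-avoids : ∀ G v ε T → ValidTree T → LeavesIn (single v ε *′ G) T → ∀ l → l ∈ label T → var l ≢ v
label-avoids G v ε (leaf D) _ D∈ l l∈D with find (∈-*′⁻ (single v ε) G D∈)
... | C , _ , unsat , D≈ = shorten′-single-avoids v ε {C} unsat (Equivalence.to (D≈ l) l∈D)
label-avoids G v ε (node R T₁ T₂) (valid₁ , valid₂ , (_ , _ , _ , _ , R≈)) (in₁ , in₂) l l∈R
  with Equivalence.to (R≈ l) l∈R
... | inj₁ l∈C₁ , _ = label-avoids G v ε T₁ valid₁ in₁ l l∈C₁
... | inj₂ l∈C₂ , _ = label-avoids G v ε T₂ valid₂ in₂ l l∈C₂

Lifting : CS → Lit → RTree → Set
Lifting G y T = Σ RTree λ T* → ValidTree T* × LeavesIn G T* × hts T* ≡ hts T ×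
                               Σ Bool λ b → Extends y b (label T) (label T*)

-- A tree over ⟨v ↦ ε⟩ * G becomes a tree over G by putting back the literal v ↦ ¬ε
-- wherever it was removed; no clause of the tree mentions v, so resolution is unaffected.
lift : ∀ G v ε T → ValidTree T → LeavesIn (single v ε *′ G) T → Lifting G (lit v (not ε)) T
lift G v ε (leaf D) _ D∈ with find (∈-*′⁻ (single v ε) G D∈)
... | C , C∈G , unsat , D≈ = leaf C , tt , ∈⇒∈CS C∈G , refl , extends (any? (lit v (not ε) ≟L_) C)
  where
  open Equivalence
  forth : ∀ l → l ∈ C → l ∈ D ⊎ l ≡ lit v (not ε)
  forth l l∈C = Data.Sum.map₁ (from (D≈ l)) (∈-shorten′-single v ε unsat l∈C)
  back : ∀ l → l ∈ D → l ∈ C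
  back l l∈D = proj₁ (∈-shorten′⁻ (single v ε) (to (D≈ l) l∈D))
  forth-without : lit v (not ε) ∉ C → ∀ l → l ∈ C → l ∈ D
  forth-without y∉C l l∈C with forth l l∈C
  ... | inj₁ l∈D = l∈D
  ... | inj₂ refl = ⊥-elim (y∉C l∈C)
  extends : Dec (lit v (not ε) ∈ C) → Σ Bool λ b → Extends (lit v (not ε)) b D C
  extends (yes y∈C) = true , λ l → mk⇔ (Data.Sum.map₂ (_, refl) ∘ forth l)
                                      λ { (inj₁ l∈D) → back l l∈D ; (inj₂ (refl , _)) → y∈C }
  extends (no y∉C)  = false , λ l → mk⇔ (inj₁ ∘ forth-without y∉C l)
                                       λ { (inj₁ l∈D) → back l l∈D ; (inj₂ (_ , ())) }
lift G v ε (node R T₁ T₂) (valid₁ , valid₂ , resolvent) (in₁ , in₂)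
  with lift G v ε T₁ valid₁ in₁ | lift G v ε T₂ valid₂ in₂
... | T₁* , valid₁* , in₁* , hts₁ , b₁ , ext₁ | T₂* , valid₂* , in₂* , hts₂ , b₂ , ext₂ =
  node (addIf (b₁ ∨ b₂) y R) T₁* T₂* ,
  (valid₁* , valid₂* , Resolvent-Extends y (label-avoids G v ε T₁ valid₁ in₁) (label-avoids G v ε T₂ valid₂ in₂)
                                          ext₁ ext₂ resolvent) ,
  (in₁* , in₂*) , cong₂ strahler hts₁ hts₂ , (b₁ ∨ b₂) , Extends-addIf y (b₁ ∨ b₂) R
  where
  y : Lit
  y = lit v (not ε)

Refutation≤ : CS → ℕ → Set
Refutation≤ G k = Σ RTree λ T → Refutation G T × hts T ≤ k

Hd≤⇒Refutation≤ : ∀ {G k} → Hd≤ G k → Refutation≤ G k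
Hd≤⇒Refutation≤ (⊥∈ ⊥∈G) = leaf [] , (tt , ∈⇒∈CS ⊥∈G , refl) , z≤n
Hd≤⇒Refutation≤ {G} {suc k} (split v ε d₁ d₂)
  with Hd≤⇒Refutation≤ d₁ | Hd≤⇒Refutation≤ d₂
... | T₁ , (valid₁ , in₁ , ⊥₁) , hts₁≤ | T₂ , (valid₂ , in₂ , ⊥₂) , hts₂≤
  with lift G v ε T₁ valid₁ in₁ | lift G v (not ε) T₂ valid₂ in₂
... | T₁* , valid₁* , in₁* , hts₁ , b₁ , ext₁ | T₂* , valid₂* , in₂* , hts₂ , b₂ , ext₂ =
  combine b₁ b₂ (subst (λ D → Extends y b₁ D (label T₁*)) ⊥₁ ext₁)
                (subst (λ D → Extends (compl y) b₂ D (label T₂*)) ⊥₂ ext₂)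
  where
  y : Lit
  y = lit v (not ε)
  hts₁*≤ : hts T₁* ≤ k
  hts₁*≤ = subst (_≤ k) (sym hts₁) hts₁≤
  hts₂*≤ : hts T₂* ≤ suc k
  hts₂*≤ = subst (_≤ suc k) (sym hts₂) hts₂≤
  combine : ∀ b₁ b₂ → Extends y b₁ [] (label T₁*) → Extends (compl y) b₂ [] (label T₂*) →
            Refutation≤ G (suc k)
  combine false _ e₁ _ = T₁* , (valid₁* , in₁* , Extends-⊥ e₁) , m≤n⇒m≤1+n hts₁*≤
  combine true false _ e₂ = T₂* , (valid₂* , in₂* , Extends-⊥ e₂) , hts₂*≤
  combine true true e₁ e₂ =
    node [] T₁* T₂* , ((valid₁* , valid₂* , unit-resolvent e₁ e₂) , (in₁* , in₂*) , refl) ,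
    strahler-≤ hts₁*≤ hts₂*≤

MinHd : CS → ℕ → Set
MinHd G a = Hd≤ G a × (∀ j → Hd≤ G j → a ≤ j)

MinHd-unique : ∀ {G a b} → MinHd G a → MinHd G b → a ≡ b
MinHd-unique (da , a-min) (db , b-min) = ≤-antisym (a-min _ db) (b-min _ da)

MinHd-exists : ∀ {G k} → Hd≤ G k → ∃ (MinHd G)
MinHd-exists {G} d = least (Hd≤? (size G) G ≤-refl) d

MinHd? : ∀ G → Dec (∃ (MinHd G))
MinHd? G = map′ MinHd-exists (λ (_ , d , _) → Hd≤-size d) (Hd≤? (size G) G ≤-refl (size G))

Refutation⇒Hd≤ : ∀ {G} → IsClauseSet G → ∀ T → Refutation G T → Hd≤ G (hts T)
Refutation⇒Hd≤ {G} icG T (valid , leaves , label≡⊥) =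
  subst (flip Hd≤ (hts T)) (*′-identity G) (tree⇒Hd≤ icG T valid leaves (lookupPA []) falsifies-⊥)
  where
  falsifies-⊥ : Falsifies (lookupPA []) (label T)
  falsifies-⊥ rewrite label≡⊥ = λ _ ()

MinHd⇒HDunsat : ∀ {G a} → IsClauseSet G → MinHd G a → HDunsat G a
MinHd⇒HDunsat icG (da , a-min) with Hd≤⇒Refutation≤ da
... | T , refutes , hts≤a = (T , refutes , ≤-antisym hts≤a (a-min _ (Refutation⇒Hd≤ icG T refutes))) ,
                            λ T′ refutes′ → a-min _ (Refutation⇒Hd≤ icG T′ refutes′)

HDunsat⇒MinHd : ∀ {G a} → IsClauseSet G → HDunsat G a → MinHd G a
HDunsat⇒MinHd icG ((T , refutes , hts≡a) , a-min) =
  subst (Hd≤ _) hts≡a (Refutation⇒Hd≤ icG T refutes) ,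
  λ j dj → let (T′ , refutes′ , hts≤j) = Hd≤⇒Refutation≤ dj in ≤-trans (a-min T′ refutes′) hts≤j

HD⇒MinHd : ∀ {G a} → IsClauseSet G → Unsat G → HD G a → MinHd G a
HD⇒MinHd icG _     (hd-unsat _ hd) = HDunsat⇒MinHd icG hd
HD⇒MinHd icG unsat hd-top = ⊥-elim (unsat ([] , refl))
HD⇒MinHd icG unsat (hd-sat sat _ _ _) = ⊥-elim (unsat sat)

assignments : List Var → List PA
assignments [] = [] ∷ []
assignments (u ∷ us) = assignments us ++ map ((u , true) ∷_) (assignments us) ++ map ((u , false) ∷_) (assignments us)

restrict : Valuation → List Var → PA
restrict f [] = []
restrict f (u ∷ us) with f u
... | nothing = restrict f us
... | just b  = (u , b) ∷ restrict f us

restrict-∈ : ∀ f us → restrict f us ∈ assignments us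
restrict-∈ f [] = here refl
restrict-∈ f (u ∷ us) with f u
... | nothing    = ∈-++⁺ˡ (restrict-∈ f us)
... | just true  = ∈-++⁺ʳ (assignments us) (∈-++⁺ˡ (∈-map⁺ _ (restrict-∈ f us)))
... | just false = ∈-++⁺ʳ (assignments us) (∈-++⁺ʳ (map _ (assignments us)) (∈-map⁺ _ (restrict-∈ f us)))

lookup-restrict-skip : ∀ f u us {w} → w ≢ u → lookupPA (restrict f (u ∷ us)) w ≡ lookupPA (restrict f us) w
lookup-restrict-skip f u us {w} w≢u with f u
... | nothing = refl
... | just b rewrite ≢⇒≡ᵇ-false w u w≢u = refl

lookup-restrict-undefined : ∀ f us {w} → f w ≡ nothing → lookupPA (restrict f us) w ≡ nothing
lookup-restrict-undefined f [] _ = refl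
lookup-restrict-undefined f (u ∷ us) {w} fw with w Data.Nat.≟ u
... | yes refl rewrite fw = lookup-restrict-undefined f us fw
... | no w≢u rewrite lookup-restrict-skip f u us w≢u = lookup-restrict-undefined f us fw

lookup-restrict-head : ∀ f u us → lookupPA (restrict f (u ∷ us)) u ≡ f u
lookup-restrict-head f u us with f u in fu
... | nothing = lookup-restrict-undefined f us fu
... | just b rewrite ≡ᵇ-refl u = refl

lookup-restrict : ∀ f us {w} → w ∈ us → lookupPA (restrict f us) w ≡ f w
lookup-restrict f (u ∷ us) {w} w∈ with w Data.Nat.≟ u
... | yes refl = lookup-restrict-head f u us
... | no w≢u = trans (lookup-restrict-skip f u us w≢u) (lookup-restrict f us (tail w≢u w∈))

*′-restrict : ∀ f G → lookupPA (restrict f (vars G)) *′ G ≡ f *′ G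
*′-restrict f G = *′-cong-on G λ C∈G l∈C → lookup-restrict f (vars G) (∈vars⁺ C∈G l∈C)

InstancesHd≤ : CS → ℕ → Set
InstancesHd≤ H a = ∀ φ k → MinHd (lookupPA φ *′ H) k → k ≤ a

Attained : CS → ℕ → Set
Attained H a = Σ PA λ φ → MinHd (lookupPA φ *′ H) a

-- hd(H) = a, where a is the largest hardness of an unsatisfiable instance φ * H
-- (for unsatisfiable H as well as satisfiable H), attained unless H = ⊤.
record HD⁺ (H : CS) (a : ℕ) : Set where
  constructor hd⁺
  field
    hd           : HD H a
    instances-≤  : InstancesHd≤ H a
    attained-or-0 : Attained H a ⊎ a ≡ 0

MinHd-*′⇒* : ∀ φ {H a} → MinHd (lookupPA φ *′ H) a → MinHd (φ * H) a
MinHd-*′⇒* φ {H} = subst (flip MinHd _) (sym (*≡*′ φ H))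

HD⁺-unsat : ∀ {H a} → IsClauseSet H → Unsat H → MinHd H a → HD⁺ H a
HD⁺-unsat {H} {a} icH unsat (da , a-min) =
  hd⁺ (hd-unsat unsat (MinHd⇒HDunsat icH (da , a-min)))
      (λ φ k (_ , k-min) → k-min a (Hd≤-*′ da (lookupPA φ)))
      (inj₁ ([] , subst (flip MinHd a) (sym (*′-identity H)) (da , a-min)))

HD⁺-⊤ : HD⁺ [] 0
HD⁺-⊤ = hd⁺ hd-top (λ φ k (dk , _) → ⊥-elim (Hd≤-⊤ dk)) (inj₂ refl)

-- Every instance of H agrees with one over var(H), and falsifying a clause of H gives an
-- unsatisfiable one, so the maximum is taken over a finite non-empty set.
HD⁺-satisfiable : ∀ C H → IsClauseSet (C ∷ H) → Satisfiable′ (C ∷ H) → ∃ (HD⁺ (C ∷ H))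
HD⁺-satisfiable C H ic@(icC ∷ _) (φ , φ*≡[])
  with maximum Instance (λ ψ → MinHd? (lookupPA ψ *′ (C ∷ H))) MinHd-unique (assignments (vars (C ∷ H)))
  where
  Instance : PA → ℕ → Set
  Instance ψ = MinHd (lookupPA ψ *′ (C ∷ H))
... | inj₂ none = ⊥-elim (none ψ 0 (restrict-∈ f (vars (C ∷ H))) falsified)
  where
  f : Valuation
  f = lookupPA (falsifier C)
  ψ : PA
  ψ = restrict f (vars (C ∷ H))
  falsified : MinHd (lookupPA ψ *′ (C ∷ H)) 0
  falsified = subst (flip MinHd 0) (sym (*′-restrict f (C ∷ H)))
                    (⊥∈ (falsified-leaf f {G = C ∷ H} (here (≈C-refl C)) (falsifier-falsifies icC)) , λ _ _ → z≤n)
... | inj₁ (ψ , a , _ , ψ-attains , a-max) =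
  a , hd⁺ hd bounded (inj₁ (ψ , ψ-attains))
  where
  ψ-attains* : MinHd (ψ * (C ∷ H)) a
  ψ-attains* = MinHd-*′⇒* ψ {C ∷ H} ψ-attains
  bounded : InstancesHd≤ (C ∷ H) a
  bounded φ′ k mk = a-max (restrict (lookupPA φ′) (vars (C ∷ H))) k (restrict-∈ (lookupPA φ′) (vars (C ∷ H)))
                          (subst (flip MinHd k) (sym (*′-restrict (lookupPA φ′) (C ∷ H))) mk)
  hd : HD (C ∷ H) a
  hd = hd-sat (φ , trans (*≡*′ φ (C ∷ H)) φ*≡[]) (λ ())
              (ψ , Hd≤⇒Unsat (proj₁ ψ-attains*) , MinHd⇒HDunsat (IsClauseSet-* ψ {C ∷ H} ic) ψ-attains*)
              (λ φ′ j _ hdj → bounded φ′ j (subst (flip MinHd j) (*≡*′ φ′ (C ∷ H))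
                                                    (HDunsat⇒MinHd (IsClauseSet-* φ′ {C ∷ H} ic) hdj)))

HD⁺-exists : ∀ H → IsClauseSet H → ∃ (HD⁺ H)
HD⁺-exists H icH with dpll (size H) H ≤-refl
... | inj₁ d = let (a , mina) = MinHd-exists d in a , HD⁺-unsat icH (Hd≤⇒Unsat d) mina
HD⁺-exists [] _ | inj₂ _ = 0 , HD⁺-⊤
HD⁺-exists (C ∷ H) icH | inj₂ sat = HD⁺-satisfiable C H icH sat

split-instance : ∀ F v f {a} → f v ≡ nothing → MinHd (f *′ F) a →
  ∃₂ λ c₀ c₁ → MinHd (f *′ single v false *′ F) c₀ × MinHd (f *′ single v true *′ F) c₁ × a ≤ strahler c₀ c₁
split-instance F v f fv≡nothing (da , a-min) with MinHd-exists (open-instance false) | MinHd-exists (open-instance true)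
  where
  open-instance : ∀ ε → Hd≤ (f *′ single v ε *′ F) _
  open-instance ε = subst (flip Hd≤ _) (*′-single-comm f v ε F fv≡nothing) (Hd≤-*′ da (single v ε))
... | c₀ , min₀ | c₁ , min₁ =
  c₀ , c₁ , min₀ , min₁ ,
  a-min _ (Hd≤-split (f *′ F) v false (from-instance false (proj₁ min₀)) (from-instance true (proj₁ min₁)))
  where
  from-instance : ∀ ε {c} → Hd≤ (f *′ single v ε *′ F) c → Hd≤ (single v ε *′ f *′ F) c
  from-instance ε = subst (flip Hd≤ _) (sym (*′-single-comm f v ε F fv≡nothing))

Dichotomy : CS → Var → ℕ → Set
Dichotomy F v a =
  (Σ Bool λ ε → Σ ℕ λ b → Σ ℕ λ c → HD (⟨ v ↦ ε ⟩ * F) b × HD (⟨ v ↦ not ε ⟩ * F) c × b ≡ a × c ≤ a)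
  ⊎ (Σ ℕ λ b → HD (⟨ v ↦ false ⟩ * F) b × HD (⟨ v ↦ true ⟩ * F) b × suc b ≡ a)

HD⁺-restriction-≤ : ∀ F v ε {a b} → InstancesHd≤ F a → HD⁺ (⟨ v ↦ ε ⟩ * F) b → b ≤ a
HD⁺-restriction-≤ F v ε {a} {b} F-≤ restricted with HD⁺.attained-or-0 restricted
... | inj₂ refl = z≤n
... | inj₁ (φ , attains) = F-≤ ((v , ε) ∷ φ) b (subst (flip MinHd b) φ*Fε≡ attains)
  where
  φ*Fε≡ : lookupPA φ *′ ⟨ v ↦ ε ⟩ * F ≡ lookupPA ((v , ε) ∷ φ) *′ F
  φ*Fε≡ = trans (cong (lookupPA φ *′_) (*≡*′ ⟨ v ↦ ε ⟩ F)) (sym (*′-∷ v ε φ F))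

HD⁺-instance-≤ : ∀ F v ε {b} → HD⁺ (⟨ v ↦ ε ⟩ * F) b → ∀ φ {k} → MinHd (lookupPA φ *′ single v ε *′ F) k → k ≤ b
HD⁺-instance-≤ F v ε restricted φ {k} mk =
  HD⁺.instances-≤ restricted φ k (subst (λ H → MinHd (lookupPA φ *′ H) k) (sym (*≡*′ ⟨ v ↦ ε ⟩ F)) mk)

hd-dichotomy : ∀ F → IsClauseSet F → ∀ v → Σ ℕ λ a → HD F a × Dichotomy F v a
hd-dichotomy F icF v with HD⁺-exists F icF
... | a , hd⁺ hdF F-≤ F-attained = a , hdF , by-cases F-attained
  where
  restricted : ∀ ε → ∃ (HD⁺ (⟨ v ↦ ε ⟩ * F))
  restricted ε = HD⁺-exists _ (IsClauseSet-* ⟨ v ↦ ε ⟩ icF)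
  b : Bool → ℕ
  b ε = proj₁ (restricted ε)
  hd : ∀ ε → HD (⟨ v ↦ ε ⟩ * F) (b ε)
  hd ε = HD⁺.hd (proj₂ (restricted ε))
  b≤a : ∀ ε → b ε ≤ a
  b≤a ε = HD⁺-restriction-≤ F v ε F-≤ (proj₂ (restricted ε))
  instance-≤b : ∀ ε φ {k} → MinHd (lookupPA φ *′ single v ε *′ F) k → k ≤ b ε
  instance-≤b ε = HD⁺-instance-≤ F v ε (proj₂ (restricted ε))
  first : ∀ ε → b ε ≡ a → Dichotomy F v a
  first ε bε≡a = inj₁ (ε , b ε , b (not ε) , hd ε , hd (not ε) , bε≡a , b≤a (not ε))
  by-cases : Attained F a ⊎ a ≡ 0 → Dichotomy F v a
  by-cases (inj₂ refl) = first false (n≤0⇒n≡0 (b≤a false))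
  by-cases (inj₁ (φ , attains)) with lookupPA φ v in φv
  ... | just ε =
    first ε (≤-antisym (b≤a ε) (instance-≤b ε φ (subst (flip MinHd a) (sym (*′-single-absorb _ v ε F φv)) attains)))
  ... | nothing with split-instance F v (lookupPA φ) φv attains
  ...   | c₀ , c₁ , min₀ , min₁ , a≤s
    with strahler-squeeze (b≤a false) (b≤a true) (instance-≤b false φ min₀) (instance-≤b true φ min₁) a≤s
  ...     | inj₁ b₀≡a = first false b₀≡a
  ...     | inj₂ (inj₁ b₁≡a) = first true b₁≡a
  ...     | inj₂ (inj₂ (b₁≡b₀ , 1+b₀≡a)) = inj₂ (b false , hd false , subst (HD _) b₁≡b₀ (hd true) , 1+b₀≡a)

hd-decreasing-assignment : ∀ F → IsClauseSet F → Unsat F → ∀ a → HD F a → 0 < a →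
  Σ Var λ v → Σ Bool λ ε → Σ ℕ λ b → v ∈var F × HD (⟨ v ↦ ε ⟩ * F) b × b < a
hd-decreasing-assignment F icF unsat (suc a) hdF _ with HD⇒MinHd icF unsat hdF
... | dF , a-min with Hd≤-normal dF
...   | inj₁ ⊥∈F = ⊥-elim (1+n≰n (≤-trans (a-min 0 (⊥∈ ⊥∈F)) z≤n))
...   | inj₂ splits with find splits
...     | v , v∈ , ε , dε , _ with HD⁺-exists (⟨ v ↦ ε ⟩ * F) (IsClauseSet-* ⟨ v ↦ ε ⟩ icF)
...       | b , hd⁺ hdε _ _ = v , ε , b , ∈vars⇒∈var v∈ , hdε , s≤s (b-min a dε*)
  where
  dε* : Hd≤ (⟨ v ↦ ε ⟩ * F) a
  dε* = subst (flip Hd≤ a) (sym (*≡*′ ⟨ v ↦ ε ⟩ F)) dε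
  b-min : ∀ j → Hd≤ (⟨ v ↦ ε ⟩ * F) j → b ≤ j
  b-min = proj₂ (HD⇒MinHd (IsClauseSet-* ⟨ v ↦ ε ⟩ icF) (Hd≤⇒Unsat dε*) hdε)

-- Part (1) does not need v ∈ var(F): otherwise both restrictions are F itself.
lemma4p1 :
    (∀ (F : CS) → IsClauseSet F → (v : Var) → v ∈var F →
      Σ ℕ λ a → HD F a ×
        ((Σ Bool λ ε → Σ ℕ λ b → Σ ℕ λ c →
            HD (⟨ v ↦ ε ⟩ * F) b × HD (⟨ v ↦ not ε ⟩ * F) c × b ≡ a × c ≤ a)
         ⊎ (Σ ℕ λ b → HD (⟨ v ↦ false ⟩ * F) b × HD (⟨ v ↦ true ⟩ * F) b × suc b ≡ a)))
    ×
    (∀ (F : CS) → IsClauseSet F → Unsat F → (a : ℕ) → HD F a → 0 < a →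
      Σ Var λ v → Σ Bool λ ε → Σ ℕ λ b →
        v ∈var F × HD (⟨ v ↦ ε ⟩ * F) b × b < a)
lemma4p1 = (λ F icF v _ → hd-dichotomy F icF v) , hd-decreasing-assignment
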